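{- Let $T$ be a transitive tournament of order $n$. Then $dib(T)=\lceil n/2\rceil$.
   Context: A tournament is a digraph obtained by orienting each edge of the complete graph $K_n$ (exactly one of $uv$, $vu$ is a dart for each pair of distinct vertices); it is transitive if it has no directed cycle. A coloring of a digraph with $k$ colors is a surjective map $\varsigma:V\to\{1,\dots,k\}$; it is acyclic if each color class induces a subdigraph with no directed cycle. With respect to $\varsigma$, a vertex $u$ is a $b^+$-vertex if for every color $j\neq\varsigma(u)$ there is a dart $uw$ with $\varsigma(w)=j$, and a $b^-$-vertex if for every color $j\neq \varsigma(u)$ there is a dart $wu$ with $\varsigma(w)=j$. A $b$-coloring is a coloring in which every color class contains a $b^+$-vertex and a $b^-$-vertex. The dib-chromatic number $dib(D)$ is the largest $k$ such that $D$ admits an acyclic $b$-coloring with $k$ colors. -}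

module Defs where

open import Data.Nat using (ℕ; zero; suc; _≤_; ⌈_/2⌉)
open import Data.Fin using (Fin; zero; suc; inject₁; fromℕ)
open import Data.Product using (Σ; ∃; _×_; _,_)
open import Data.Sum using (_⊎_)
open import Data.Unit using (⊤)
open import Relation.Nullary using (¬_)
open import Relation.Binary.PropositionalEquality using (_≡_; _≢_)
open import Function.Definitions using (Injective; Surjective)

Digraph : ℕ → Set₁
Digraph n = Fin n → Fin n → Set

IsTournament : ∀ {n} → Digraph n → Set
IsTournament {n} D =
  (∀ (u : Fin n) → ¬ D u u) ×
  (∀ (u v : Fin n) → u ≢ v → (D u v × ¬ D v u) ⊎ (D v u × ¬ D u v))

record DirectedCycleIn {n} (D : Digraph n) (P : Fin n → Set) : Set where
  field
    len     : ℕ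
    vert    : Fin (suc len) → Fin n
    distinct : Injective _≡_ _≡_ vert
    step    : ∀ (i : Fin len) → D (vert (inject₁ i)) (vert (suc i))
    close   : D (vert (fromℕ len)) (vert zero)
    inside  : ∀ (i : Fin (suc len)) → P (vert i)

IsAcyclicDigraph : ∀ {n} → Digraph n → Set
IsAcyclicDigraph D = ¬ DirectedCycleIn D (λ _ → ⊤)

IsTransitiveTournament : ∀ {n} → Digraph n → Set
IsTransitiveTournament D = IsTournament D × IsAcyclicDigraph D

-- A coloring with k colors: a surjective map to Fin k (colors 1..k ↦ 0..k-1).
IsColoring : ∀ {n} (k : ℕ) → (Fin n → Fin k) → Set
IsColoring {n} k σ = Surjective {A = Fin n} _≡_ _≡_ σ

IsAcyclicColoring : ∀ {n k} → Digraph n → (Fin n → Fin k) → Set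
IsAcyclicColoring {n} {k} D σ = ∀ (j : Fin k) → ¬ DirectedCycleIn D (λ v → σ v ≡ j)

IsBPlus : ∀ {n k} → Digraph n → (Fin n → Fin k) → Fin n → Set
IsBPlus {n} {k} D σ u = ∀ (j : Fin k) → j ≢ σ u → ∃ λ (w : Fin n) → D u w × σ w ≡ j

IsBMinus : ∀ {n k} → Digraph n → (Fin n → Fin k) → Fin n → Set
IsBMinus {n} {k} D σ u = ∀ (j : Fin k) → j ≢ σ u → ∃ λ (w : Fin n) → D w u × σ w ≡ j

IsBColoring : ∀ {n} (k : ℕ) → Digraph n → (Fin n → Fin k) → Set
IsBColoring {n} k D σ =
  IsColoring k σ ×
  (∀ (j : Fin k) →
     (∃ λ (u : Fin n) → σ u ≡ j × IsBPlus D σ u) ×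
     (∃ λ (u : Fin n) → σ u ≡ j × IsBMinus D σ u))

HasAcyclicBColoring : ∀ {n} → Digraph n → ℕ → Set
HasAcyclicBColoring {n} D k =
  ∃ λ (σ : Fin n → Fin k) → IsBColoring k D σ × IsAcyclicColoring D σ

DibEq : ∀ {n} → Digraph n → ℕ → Set
DibEq D m = HasAcyclicBColoring D m × (∀ (k : ℕ) → HasAcyclicBColoring D k → k ≤ m)

{-# OPTIONS --safe #-}
module Submission where

-- Rank the vertices of T by in-degree, so that darts go from lower to higher positions
-- 0, …, n-1, and colour position x by its distance x ⊓ (n-1-x) to the nearer end. This uses
-- ⌈n/2⌉ colours; colour j occupies positions j and n-1-j, and since j < n-1-i for distinct
-- colours i, j, position j is a b⁺-vertex and position n-1-j a b⁻-vertex. Conversely, in a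
-- b-colouring of a tournament the b⁺-vertices of two singleton classes would have to dominate
-- each other, so at most one class is a singleton and a b-colouring with k colours has 2k-1 ≤ n.

open import Defs
open import Data.Nat using (ℕ; zero; suc; _+_; _∸_; _⊓_; _≤_; _<_; z≤n; s≤s; ⌈_/2⌉)
open import Data.Nat.Properties
  using ( +-suc; +-mono-≤; +-mono-<-≤; +-mono-≤-<; +-monoˡ-≤; ≤-trans; ≤-<-trans; ≤-pred
        ; ≮⇒≥; ≰⇒>; ≤⇒≯; <-irrefl; <-asym; <⇒≢; <-cmp; n<1+n; m+[n∸m]≡n; m+n≤o⇒m≤o∸n
        ; ⊓-comm; m⊓n≤m; m⊓n≤n; m≤n⇒m⊓n≡m; ⌊n/2⌋≤⌈n/2⌉; ⌊n/2⌋+⌈n/2⌉≡n; ⌈n/2⌉≤n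
        ; module ≤-Reasoning )
open import Data.Fin using (Fin; zero; suc; toℕ; fromℕ<; inject₁; inject≤; opposite; punchOut; splitAt; join)
open import Data.Fin.Properties
  using ( _≟_; any?; toℕ<n; toℕ-fromℕ<; toℕ-injective; toℕ-inject≤; opposite-prop
        ; opposite-involutive; injective⇒≤; punchOut-injective; join-splitAt )
  renaming (suc-injective to Fin-suc-injective)
open import Data.Fin.Subset using (Subset; _∈_; ∣_∣)
open import Data.Fin.Subset.Properties using (p⊂q⇒∣p∣<∣q∣; ∣⊤∣≡n; ⊆⊤; ∈⊤)
open import Data.Vec using (tabulate)
open import Data.Vec.Properties using (lookup∘tabulate; lookup⇒[]=; []=⇒lookup)
open import Data.Bool using (true)
open import Data.Product using (∃; _×_; _,_; proj₁; proj₂)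
open import Data.Sum using (_⊎_; inj₁; inj₂; [_,_]′)
open import Data.Unit using (⊤; tt)
open import Function using (_∘_)
open import Function.Definitions using (Injective; Surjective)
open import Relation.Nullary using (¬_; Dec; yes; no; does; contradiction)
open import Relation.Nullary.Decidable using (dec-true; decidable-stable; _×-dec_; ¬?)
open import Relation.Binary.Definitions
  using (Asymmetric; Transitive; Trichotomous; tri<; tri≈; tri>)
open import Relation.Binary.Consequences using (tri⇒asym; tri⇒dec<)
open import Relation.Binary.PropositionalEquality
  using (_≡_; _≢_; refl; sym; trans; cong; subst; subst₂; module ≡-Reasoning)

n≤⌈n/2⌉+⌈n/2⌉ : ∀ n → n ≤ ⌈ n /2⌉ + ⌈ n /2⌉
n≤⌈n/2⌉+⌈n/2⌉ n =
  subst (_≤ ⌈ n /2⌉ + ⌈ n /2⌉) (⌊n/2⌋+⌈n/2⌉≡n n) (+-monoˡ-≤ ⌈ n /2⌉ (⌊n/2⌋≤⌈n/2⌉ n))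

⌈n/2⌉+⌈n/2⌉≤1+n : ∀ n → ⌈ n /2⌉ + ⌈ n /2⌉ ≤ suc n
⌈n/2⌉+⌈n/2⌉≤1+n zero          = z≤n
⌈n/2⌉+⌈n/2⌉≤1+n (suc zero)    = s≤s (s≤s z≤n)
⌈n/2⌉+⌈n/2⌉≤1+n (suc (suc n)) =
  s≤s (subst (_≤ suc (suc n)) (sym (+-suc ⌈ n /2⌉ ⌈ n /2⌉)) (s≤s (⌈n/2⌉+⌈n/2⌉≤1+n n)))

m+m≤1+n⇒m≤⌈n/2⌉ : ∀ {m n} → m + m ≤ suc n → m ≤ ⌈ n /2⌉
m+m≤1+n⇒m≤⌈n/2⌉ {m} {n} m+m≤1+n = ≮⇒≥ λ ⌈n/2⌉<m → ≤⇒≯ m+m≤1+n (begin-strict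
  suc n                       ≤⟨ s≤s (n≤⌈n/2⌉+⌈n/2⌉ n) ⟩
  suc (⌈ n /2⌉ + ⌈ n /2⌉)     <⟨ n<1+n _ ⟩
  suc (suc (⌈ n /2⌉ + ⌈ n /2⌉)) ≡⟨ cong suc (sym (+-suc ⌈ n /2⌉ ⌈ n /2⌉)) ⟩
  suc ⌈ n /2⌉ + suc ⌈ n /2⌉   ≤⟨ +-mono-≤ ⌈n/2⌉<m ⌈n/2⌉<m ⟩
  m + m                       ∎)
  where open ≤-Reasoning

1+m+1+n<o+o : ∀ {m n o} → m < o → n < o → m ≢ n → suc m + suc n < o + o
1+m+1+n<o+o {m} {n} m<o n<o m≢n with <-cmp m n
... | tri< m<n _ _ = +-mono-<-≤ (≤-<-trans m<n n<o) n<o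
... | tri≈ _ m≡n _ = contradiction m≡n m≢n
... | tri> _ _ n<m = +-mono-≤-< m<o (≤-<-trans n<m m<o)

m<⌈n/2⌉⇒m≤n∸[1+m] : ∀ {m n} → m < ⌈ n /2⌉ → m ≤ n ∸ suc m
m<⌈n/2⌉⇒m≤n∸[1+m] {m} {n} m<h =
  m+n≤o⇒m≤o∸n m (≤-pred (≤-trans (+-mono-≤ m<h m<h) (⌈n/2⌉+⌈n/2⌉≤1+n n)))

m≢o⇒m<n∸[1+o] : ∀ {m n o} → m < ⌈ n /2⌉ → o < ⌈ n /2⌉ → m ≢ o → m < n ∸ suc o
m≢o⇒m<n∸[1+o] {n = n} m<h o<h m≢o =
  m+n≤o⇒m≤o∸n _ (≤-pred (≤-trans (1+m+1+n<o+o m<h o<h m≢o) (⌈n/2⌉+⌈n/2⌉≤1+n n)))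

injective⇒surjective : ∀ {n} {f : Fin n → Fin n} → Injective _≡_ _≡_ f → Surjective _≡_ _≡_ f
injective⇒surjective {f = f} f-injective y with any? (λ x → f x ≟ y)
... | yes (x , fx≡y) = x , λ { refl → fx≡y }
injective⇒surjective {suc n} {f} f-injective y | no ¬hit =
  contradiction (injective⇒≤ punchOut∘f-injective) (<-irrefl refl)
  where
  y≢f : ∀ x → y ≢ f x
  y≢f x y≡fx = ¬hit (x , sym y≡fx)
  punchOut∘f-injective : Injective _≡_ _≡_ (λ x → punchOut (y≢f x))
  punchOut∘f-injective {a} {b} = f-injective ∘ punchOut-injective (y≢f a) (y≢f b)

splitAt-injective : ∀ m {n} → Injective _≡_ _≡_ (splitAt m {n})
splitAt-injective m {n} {a} {b} e =
  trans (sym (join-splitAt m n a)) (trans (cong (join m n) e) (join-splitAt m n b))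

does≡true⇒ : ∀ {A : Set} (a? : Dec A) → does a? ≡ true → A
does≡true⇒ (yes a) _  = a
does≡true⇒ (no _)  ()

triangle : ∀ {n} {D : Digraph n} → (∀ u → ¬ D u u) →
           ∀ {u v w} → D u v → D v w → D w u → DirectedCycleIn D (λ _ → ⊤)
triangle {n} {D} irreflexive {u} {v} {w} uv vw wu = record
  { len = 2 ; vert = vertex ; distinct = distinct ; step = step ; close = wu ; inside = λ _ → tt }
  where
  dart⇒≢ : ∀ {x y} → D x y → x ≢ y
  dart⇒≢ xy refl = irreflexive _ xy
  vertex : Fin 3 → Fin n
  vertex zero             = u
  vertex (suc zero)       = v
  vertex (suc (suc zero)) = w
  distinct : Injective _≡_ _≡_ vertex
  distinct {zero}             {zero}             _ = refl
  distinct {suc zero}         {suc zero}         _ = refl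
  distinct {suc (suc zero)}   {suc (suc zero)}   _ = refl
  distinct {zero}             {suc zero}         e = contradiction e (dart⇒≢ uv)
  distinct {suc zero}         {zero}             e = contradiction (sym e) (dart⇒≢ uv)
  distinct {suc zero}         {suc (suc zero)}   e = contradiction e (dart⇒≢ vw)
  distinct {suc (suc zero)}   {suc zero}         e = contradiction (sym e) (dart⇒≢ vw)
  distinct {suc (suc zero)}   {zero}             e = contradiction e (dart⇒≢ wu)
  distinct {zero}             {suc (suc zero)}   e = contradiction (sym e) (dart⇒≢ wu)
  step : ∀ i → D (vertex (inject₁ i)) (vertex (suc i))
  step zero       = uv
  step (suc zero) = vw

IsAcyclicDigraph⇒IsAcyclicColoring : ∀ {n k} {D : Digraph n} → IsAcyclicDigraph D →
                                     (σ : Fin n → Fin k) → IsAcyclicColoring D σ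
IsAcyclicDigraph⇒IsAcyclicColoring acyclic σ j cycle = acyclic (record
  { len = len ; vert = vert ; distinct = distinct ; step = step ; close = close ; inside = λ _ → tt })
  where open DirectedCycleIn cycle

representatives⇒IsBColoring :
  ∀ {n k} {D : Digraph n} {σ : Fin n → Fin k} (b⁺ b⁻ : Fin k → Fin n) →
  (∀ j → σ (b⁺ j) ≡ j) → (∀ j → σ (b⁻ j) ≡ j) → (∀ {i j} → i ≢ j → D (b⁺ i) (b⁻ j)) →
  IsBColoring k D σ
representatives⇒IsBColoring {σ = σ} b⁺ b⁻ σ-b⁺ σ-b⁻ dart =
  (λ j → b⁺ j , λ { refl → σ-b⁺ j }) ,
  λ j → (b⁺ j , σ-b⁺ j , λ i i≢σb⁺j → b⁻ i , dart (≢σ⇒≢ σ-b⁺ i≢σb⁺j) , σ-b⁻ i)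
      , (b⁻ j , σ-b⁻ j , λ i i≢σb⁻j → b⁺ i , dart (≢σ⇒≢ σ-b⁻ i≢σb⁻j ∘ sym) , σ-b⁺ i)
  where
  ≢σ⇒≢ : ∀ {b : Fin _ → Fin _} {i j} → (∀ j → σ (b j) ≡ j) → i ≢ σ (b j) → j ≢ i
  ≢σ⇒≢ {j = j} σ-b i≢σbj j≡i = i≢σbj (trans (sym j≡i) (sym (σ-b j)))

module Tournament {n} {T : Digraph n} (tournament : IsTournament T) where

  compare : Trichotomous _≡_ T
  compare u v with u ≟ v
  ... | yes refl = tri≈ (proj₁ tournament u) refl (proj₁ tournament u)
  ... | no u≢v with proj₂ tournament u v u≢v
  ...   | inj₁ (uv , ¬vu) = tri< uv u≢v ¬vu
  ...   | inj₂ (vu , ¬uv) = tri> ¬uv u≢v vu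

  asymmetric : Asymmetric T
  asymmetric = tri⇒asym compare

  module _ (r : Fin n → ℕ) (r-mono : ∀ {u v} → T u v → r u < r v) where

    r<⇒dart : ∀ {u v} → r u < r v → T u v
    r<⇒dart {u} {v} ru<rv with compare u v
    ... | tri< uv _ _    = uv
    ... | tri≈ _ refl _ = contradiction refl (<⇒≢ ru<rv)
    ... | tri> _ _ vu    = contradiction (r-mono vu) (<-asym ru<rv)

    r-injective : Injective _≡_ _≡_ r
    r-injective {u} {v} ru≡rv with compare u v
    ... | tri< uv _ _    = contradiction ru≡rv (<⇒≢ (r-mono uv))
    ... | tri≈ _ u≡v _   = u≡v
    ... | tri> _ _ vu    = contradiction (sym ru≡rv) (<⇒≢ (r-mono vu))

module TransitiveTournament {n} {T : Digraph n} (transitiveTournament : IsTransitiveTournament T) where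

  open Tournament (proj₁ transitiveTournament)

  irreflexive : ∀ u → ¬ T u u
  irreflexive = proj₁ (proj₁ transitiveTournament)

  transitive : Transitive T
  transitive {u} {v} {w} uv vw with compare u w
  ... | tri< uw _ _    = uw
  ... | tri≈ _ refl _ = contradiction vw (asymmetric uv)
  ... | tri> _ _ wu    = contradiction (triangle irreflexive uv vw wu) (proj₂ transitiveTournament)

  inNeighbours : Fin n → Subset n
  inNeighbours v = tabulate (λ u → does (tri⇒dec< compare u v))

  dart⇒∈inNeighbours : ∀ {u v} → T u v → u ∈ inNeighbours v
  dart⇒∈inNeighbours {u} {v} uv =
    lookup⇒[]= u (inNeighbours v) (trans (lookup∘tabulate _ u) (dec-true (tri⇒dec< compare u v) uv))

  ∈inNeighbours⇒dart : ∀ {u v} → u ∈ inNeighbours v → T u v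
  ∈inNeighbours⇒dart {u} {v} u∈ =
    does≡true⇒ (tri⇒dec< compare u v) (trans (sym (lookup∘tabulate _ u)) ([]=⇒lookup u∈))

  inDegree : Fin n → ℕ
  inDegree v = ∣ inNeighbours v ∣

  inDegree<n : ∀ v → inDegree v < n
  inDegree<n v = subst (inDegree v <_) (∣⊤∣≡n n)
    (p⊂q⇒∣p∣<∣q∣ (⊆⊤ , v , ∈⊤ , irreflexive v ∘ ∈inNeighbours⇒dart))

  inDegree-mono : ∀ {u v} → T u v → inDegree u < inDegree v
  inDegree-mono {u} {v} uv = p⊂q⇒∣p∣<∣q∣
    ( (λ w∈ → dart⇒∈inNeighbours (transitive (∈inNeighbours⇒dart w∈) uv))
    , u , dart⇒∈inNeighbours uv , irreflexive u ∘ ∈inNeighbours⇒dart )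

  rank : Fin n → Fin n
  rank v = fromℕ< (inDegree<n v)

  rank-injective : Injective _≡_ _≡_ rank
  rank-injective {u} {v} e =
    r-injective inDegree inDegree-mono (trans (sym (toℕ-fromℕ< _)) (trans (cong toℕ e) (toℕ-fromℕ< _)))

  vertexAt : Fin n → Fin n
  vertexAt i = proj₁ (injective⇒surjective rank-injective i)

  rank-vertexAt : ∀ i → rank (vertexAt i) ≡ i
  rank-vertexAt i = proj₂ (injective⇒surjective rank-injective i) refl

  inDegree-vertexAt : ∀ i → inDegree (vertexAt i) ≡ toℕ i
  inDegree-vertexAt i = trans (sym (toℕ-fromℕ< _)) (cong toℕ (rank-vertexAt i))

  vertexAt-ascending : ∀ {i j} → toℕ i < toℕ j → T (vertexAt i) (vertexAt j)
  vertexAt-ascending {i} {j} i<j =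
    r<⇒dart inDegree inDegree-mono (subst₂ _<_ (sym (inDegree-vertexAt i)) (sym (inDegree-vertexAt j)) i<j)

distanceToEnds : ∀ {n} → Fin n → ℕ
distanceToEnds i = toℕ i ⊓ toℕ (opposite i)

distanceToEnds-opposite : ∀ {n} (i : Fin n) → distanceToEnds (opposite i) ≡ distanceToEnds i
distanceToEnds-opposite i =
  trans (cong (λ j → toℕ (opposite i) ⊓ toℕ j) (opposite-involutive i)) (⊓-comm _ _)

1+toℕ+toℕ-opposite≡n : ∀ {n} (i : Fin n) → suc (toℕ i) + toℕ (opposite i) ≡ n
1+toℕ+toℕ-opposite≡n i = trans (cong (suc (toℕ i) +_) (opposite-prop i)) (m+[n∸m]≡n (toℕ<n i))

distanceToEnds<⌈n/2⌉ : ∀ {n} (i : Fin n) → distanceToEnds i < ⌈ n /2⌉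
distanceToEnds<⌈n/2⌉ {n} i = ≰⇒> λ h≤d → ≤⇒≯ (n≤⌈n/2⌉+⌈n/2⌉ n) (begin-strict
  ⌈ n /2⌉ + ⌈ n /2⌉                      ≤⟨ +-mono-≤ h≤d h≤d ⟩
  distanceToEnds i + distanceToEnds i    ≤⟨ +-mono-≤ (m⊓n≤m (toℕ i) (toℕ (opposite i)))
                                                     (m⊓n≤n (toℕ i) (toℕ (opposite i))) ⟩
  toℕ i + toℕ (opposite i)               <⟨ n<1+n _ ⟩
  suc (toℕ i) + toℕ (opposite i)         ≡⟨ 1+toℕ+toℕ-opposite≡n i ⟩
  n                                      ∎)
  where open ≤-Reasoning

module PositionColouring (n : ℕ) where

  colour : Fin n → Fin ⌈ n /2⌉
  colour i = fromℕ< (distanceToEnds<⌈n/2⌉ i)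

  low : Fin ⌈ n /2⌉ → Fin n
  low j = inject≤ j (⌈n/2⌉≤n n)

  high : Fin ⌈ n /2⌉ → Fin n
  high j = opposite (low j)

  toℕ-high : ∀ j → toℕ (high j) ≡ n ∸ suc (toℕ j)
  toℕ-high j = trans (opposite-prop (low j)) (cong (λ a → n ∸ suc a) (toℕ-inject≤ j _))

  distanceToEnds-low : ∀ j → distanceToEnds (low j) ≡ toℕ j
  distanceToEnds-low j = trans (m≤n⇒m⊓n≡m low≤high) (toℕ-inject≤ j _)
    where
    low≤high : toℕ (low j) ≤ toℕ (high j)
    low≤high = subst₂ _≤_ (sym (toℕ-inject≤ j _)) (sym (toℕ-high j)) (m<⌈n/2⌉⇒m≤n∸[1+m] (toℕ<n j))

  colour-low : ∀ j → colour (low j) ≡ j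
  colour-low j = toℕ-injective (trans (toℕ-fromℕ< _) (distanceToEnds-low j))

  colour-high : ∀ j → colour (high j) ≡ j
  colour-high j = toℕ-injective (begin
    toℕ (colour (high j))   ≡⟨ toℕ-fromℕ< _ ⟩
    distanceToEnds (high j) ≡⟨ distanceToEnds-opposite (low j) ⟩
    distanceToEnds (low j)  ≡⟨ distanceToEnds-low j ⟩
    toℕ j                   ∎)
    where open ≡-Reasoning

  low<high : ∀ {i j} → i ≢ j → toℕ (low i) < toℕ (high j)
  low<high {i} {j} i≢j = subst₂ _<_ (sym (toℕ-inject≤ i _)) (sym (toℕ-high j))
    (m≢o⇒m<n∸[1+o] (toℕ<n i) (toℕ<n j) (i≢j ∘ toℕ-injective))

module OrientedBColouring {n k} {D : Digraph n} {σ : Fin n → Fin k} (asymmetric : Asymmetric D)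
  (b⁺ : ∀ j → ∃ λ u → σ u ≡ j × IsBPlus D σ u) where

  centre : Fin k → Fin n
  centre j = proj₁ (b⁺ j)

  σ-centre : ∀ j → σ (centre j) ≡ j
  σ-centre j = proj₁ (proj₂ (b⁺ j))

  HasSecond : Fin k → Set
  HasSecond j = ∃ λ v → σ v ≡ j × v ≢ centre j

  hasSecond? : ∀ j → Dec (HasSecond j)
  hasSecond? j = any? (λ v → (σ v ≟ j) ×-dec ¬? (v ≟ centre j))

  σ⁻¹-singleton : ∀ {j v} → ¬ HasSecond j → σ v ≡ j → v ≡ centre j
  σ⁻¹-singleton {j} {v} ¬second σv≡j =
    decidable-stable (v ≟ centre j) (λ v≢centre → ¬second (v , σv≡j , v≢centre))

  centre→singleton : ∀ {i j} → ¬ HasSecond j → i ≢ j → D (centre i) (centre j)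
  centre→singleton {i} {j} ¬second i≢j
    with proj₂ (proj₂ (b⁺ i)) j (λ j≡σ → i≢j (trans (sym (σ-centre i)) (sym j≡σ)))
  ... | w , dart , σw≡j = subst (D (centre i)) (σ⁻¹-singleton ¬second σw≡j) dart

  singleton-unique : ∀ {i j} → ¬ HasSecond i → ¬ HasSecond j → i ≡ j
  singleton-unique {i} {j} ¬second-i ¬second-j = decidable-stable (i ≟ j) λ i≢j →
    asymmetric (centre→singleton ¬second-j i≢j) (centre→singleton ¬second-i (i≢j ∘ sym))

  -- zero is shared by the singleton classes, of which there is at most one.
  second : Fin k → Fin (suc n)
  second j with hasSecond? j
  ... | yes (v , _) = suc v
  ... | no _        = zero

  suc-centre≢second : ∀ i j → suc (centre i) ≢ second j
  suc-centre≢second i j with hasSecond? j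
  ... | yes (v , σv≡j , v≢centre) = λ e →
    let centre≡v = Fin-suc-injective e
    in v≢centre (trans (sym centre≡v) (cong centre (trans (sym (σ-centre i)) (trans (cong σ centre≡v) σv≡j))))
  ... | no _ = λ ()

  second-injective : Injective _≡_ _≡_ second
  second-injective {i} {j} with hasSecond? i | hasSecond? j
  ... | yes (v , σv≡i , _) | yes (w , σw≡j , _) =
    λ e → trans (sym σv≡i) (trans (cong σ (Fin-suc-injective e)) σw≡j)
  ... | yes _ | no _ = λ ()
  ... | no _ | yes _ = λ ()
  ... | no ¬second-i | no ¬second-j = λ _ → singleton-unique ¬second-i ¬second-j

  witness : Fin k ⊎ Fin k → Fin (suc n)
  witness = [ suc ∘ centre , second ]′

  witness-injective : Injective _≡_ _≡_ witness
  witness-injective {inj₁ i} {inj₁ j} e =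
    cong inj₁ (trans (sym (σ-centre i)) (trans (cong σ (Fin-suc-injective e)) (σ-centre j)))
  witness-injective {inj₁ i} {inj₂ j} e = contradiction e (suc-centre≢second i j)
  witness-injective {inj₂ i} {inj₁ j} e = contradiction (sym e) (suc-centre≢second j i)
  witness-injective {inj₂ i} {inj₂ j} e = cong inj₂ (second-injective e)

  k+k≤1+n : k + k ≤ suc n
  k+k≤1+n = injective⇒≤ (splitAt-injective k ∘ witness-injective)

transitiveTournament⇒HasAcyclicBColoring : ∀ {n} {T : Digraph n} → IsTransitiveTournament T →
                                            HasAcyclicBColoring T ⌈ n /2⌉
transitiveTournament⇒HasAcyclicBColoring {n} {T} transitiveTournament =
  colour ∘ rank ,
  representatives⇒IsBColoring (vertexAt ∘ low) (vertexAt ∘ high)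
    (λ j → trans (cong colour (rank-vertexAt (low j))) (colour-low j))
    (λ j → trans (cong colour (rank-vertexAt (high j))) (colour-high j))
    (vertexAt-ascending ∘ low<high) ,
  IsAcyclicDigraph⇒IsAcyclicColoring (proj₂ transitiveTournament) (colour ∘ rank)
  where
  open TransitiveTournament transitiveTournament
  open PositionColouring n

tournament-HasAcyclicBColoring⇒≤⌈n/2⌉ : ∀ {n k} {T : Digraph n} → IsTournament T →
                                        HasAcyclicBColoring T k → k ≤ ⌈ n /2⌉
tournament-HasAcyclicBColoring⇒≤⌈n/2⌉ tournament (_ , (_ , classes) , _) =
  m+m≤1+n⇒m≤⌈n/2⌉ (OrientedBColouring.k+k≤1+n (Tournament.asymmetric tournament) (proj₁ ∘ classes))

corollary7 : ∀ (n : ℕ) (T : Digraph n) → IsTransitiveTournament T → DibEq T ⌈ n /2⌉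
corollary7 n T transitiveTournament =
  transitiveTournament⇒HasAcyclicBColoring transitiveTournament ,
  λ k → tournament-HasAcyclicBColoring⇒≤⌈n/2⌉ (proj₁ transitiveTournament)
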